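{- Let $G$ be a graph with two subgraphs $G_X,G_Y$ such that $G=G_X\cup G_Y$ and $G_X\cap G_Y$ is connected. If $\mathcal{B}_X$ and $\mathcal{B}_Y$ are cycle bases of $G_X$ and $G_Y$ respectively, then $\mathcal{B}_X\cup\mathcal{B}_Y$ generates the cycle space of $G$. In particular $\mathrm{bn}(G)\le\mathrm{bn}(G_X)+\mathrm{bn}(G_Y)$.
   Context: All graphs are finite and simple. Union and intersection of subgraphs are taken on vertex sets and edge sets. Subsets of $E(G)$ form an $\mathbb{F}_2$-vector space under symmetric difference; an $\mathbb{F}_2$-cycle is a subgraph with all degrees even; these form the cycle space, a cycle basis is a basis of it. The congestion of a family of subgraphs is the maximum over edges $e$ of the number of members containing $e$; $\mathrm{bn}(G)$ is the minimum congestion of a cycle basis of $G$. -}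

module Defs where

open import Data.Nat using (ℕ; zero; suc; _+_; _⊔_; _≤_)
open import Data.Nat.Divisibility using (_∣_)
open import Data.Bool using (Bool; true; false; _∨_; _xor_)
open import Data.Fin using (Fin; _≟_)
open import Data.Fin.Subset using (Subset; _∈_; _⊆_; _∩_; _∪_; ∣_∣; ⊤) renaming (⊥ to ∅)
open import Data.Vec using (Vec; []; _∷_; zipWith; tabulate; foldr′; lookup)
open import Data.Product using (Σ; ∃; ∃-syntax; _×_; _,_; proj₁; proj₂)
open import Data.Sum using (_⊎_)
open import Relation.Nullary using (¬_)
open import Relation.Nullary.Decidable using (⌊_⌋)
open import Relation.Binary.PropositionalEquality using (_≡_; _≢_)

record Graph : Set where
  field
    n m       : ℕ
    ends      : Fin m → Fin n × Fin n
    loopless  : ∀ e → proj₁ (ends e) ≢ proj₂ (ends e)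
    noParallel : ∀ e f →
      (ends e ≡ ends f ⊎ (proj₁ (ends e) ≡ proj₂ (ends f) × proj₂ (ends e) ≡ proj₁ (ends f)))
      → e ≡ f
open Graph public

EdgeSet : Graph → Set
EdgeSet G = Subset (m G)

record Subgraph (G : Graph) : Set where
  field
    V      : Subset (n G)
    E      : EdgeSet G
    closed : ∀ e → e ∈ E → proj₁ (ends G e) ∈ V × proj₂ (ends G e) ∈ V
open Subgraph public

_⊕_ : ∀ {k} → Subset k → Subset k → Subset k
_⊕_ = zipWith _xor_

incident : (G : Graph) → Fin (n G) → EdgeSet G
incident G v = tabulate λ e → ⌊ v ≟ proj₁ (ends G e) ⌋ ∨ ⌊ v ≟ proj₂ (ends G e) ⌋

deg : (G : Graph) → EdgeSet G → Fin (n G) → ℕ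
deg G S v = ∣ S ∩ incident G v ∣

-- S is (the edge set of) an F₂-cycle of the subgraph with edge set H:
-- S ⊆ H and every vertex has even degree.
IsCycle : (G : Graph) → EdgeSet G → EdgeSet G → Set
IsCycle G H S = S ⊆ H × (∀ v → 2 ∣ deg G S v)

lincomb : (G : Graph) → ∀ {k} → Vec Bool k → Vec (EdgeSet G) k → EdgeSet G
lincomb G [] [] = ∅
lincomb G (true ∷ c) (B ∷ Bs) = B ⊕ lincomb G c Bs
lincomb G (false ∷ c) (B ∷ Bs) = lincomb G c Bs

Generates : (G : Graph) → EdgeSet G → ∀ {k} → Vec (EdgeSet G) k → Set
Generates G H {k} B = ∀ S → IsCycle G H S → ∃[ c ] lincomb G {k} c B ≡ S

LinIndep : (G : Graph) → ∀ {k} → Vec (EdgeSet G) k → Set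
LinIndep G {k} B = ∀ (c : Vec Bool k) → lincomb G c B ≡ ∅ → c ≡ Data.Vec.replicate k false

IsCycleBasis : (G : Graph) → EdgeSet G → ∀ {k} → Vec (EdgeSet G) k → Set
IsCycleBasis G H B =
  (∀ i → IsCycle G H (lookup B i)) × LinIndep G B × Generates G H B

load : (G : Graph) → ∀ {k} → Vec (EdgeSet G) k → Fin (m G) → ℕ
load G [] e = 0
load G (B ∷ Bs) e with lookup B e
... | true  = suc (load G Bs e)
... | false = load G Bs e

congestion : (G : Graph) → ∀ {k} → Vec (EdgeSet G) k → ℕ
congestion G B = foldr′ _⊔_ 0 (tabulate (load G B))

IsBn : (G : Graph) → EdgeSet G → ℕ → Set
IsBn G H b =
  (∃[ k ] Σ (Vec (EdgeSet G) k) λ B → IsCycleBasis G H B × congestion G B ≡ b)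
  × (∀ {k} (B : Vec (EdgeSet G) k) → IsCycleBasis G H B → b ≤ congestion G B)

data Reach (G : Graph) (V : Subset (n G)) (E : EdgeSet G) : Fin (n G) → Fin (n G) → Set where
  here : ∀ {u} → u ∈ V → Reach G V E u u
  step : ∀ {u w v} (e : Fin (m G)) → e ∈ E →
         ((ends G e ≡ (u , w)) ⊎ (ends G e ≡ (w , u))) →
         u ∈ V → Reach G V E w v → Reach G V E u v

Connected : (G : Graph) → Subset (n G) → EdgeSet G → Set
Connected G V E = (∃[ v ] v ∈ V) × (∀ u v → u ∈ V → v ∈ V → Reach G V E u v)

-- Over F₂, let ∂ send an edge set to its set of odd-degree vertices, so cycles are the
-- edge sets with ∂ = 0. Split a cycle S of G as S_X = S ∩ E(G_X) and S_Y = S ∖ E(G_X),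
-- which lies in E(G_Y). Then ∂S_X = ∂S_Y has even size and lies in V(G_X) ∩ V(G_Y), so by
-- connectivity of G_X ∩ G_Y it is the boundary of a sum T of paths inside G_X ∩ G_Y.
-- Now S_X + T and S_Y + T are cycles of G_X and G_Y with sum S, so B_X ∪ B_Y generates.
-- Pruning B_X ++ B_Y greedily to a basis with the same span raises no edge load, whence
-- bn(G) ≤ congestion (B_X ++ B_Y) ≤ bn(G_X) + bn(G_Y).

module Submission where

open import Defs
open import Algebra.Bundles using (CommutativeRing)
open import Data.Bool using (Bool; true; false; not; _∧_; _∨_; _xor_)
open import Data.Bool.Properties
  using (xor-∧-commutativeRing; xor-same; xor-identityˡ; xor-identityʳ; xor-comm; xor-assoc;
         xor-inverseʳ; not-¬; not-involutive; ∧-identityʳ; ∧-zeroʳ; ∧-assoc; ∧-comm; ∧-conicalʳ;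
         ∧-distribˡ-xor; ∧-distribʳ-xor)
  renaming (_≟_ to _≟ᵇ_)
open import Data.Fin using (Fin; zero; suc; _≟_)
open import Data.Nat using (ℕ; zero; suc; _+_; _*_; _≤_; _⊔_; z≤n; s≤s)
open import Data.Nat.Properties using (≤-refl; ≤-trans; n≤1+n; m≤m⊔n; m≤n⊔m; ⊔-lub; +-mono-≤)
open import Data.Nat.Divisibility using (_∣_; divides)
open import Data.Product using (Σ; ∃₂; ∃-syntax; _×_; _,_; proj₁; proj₂)
open import Data.Empty using (⊥-elim)
open import Data.Sum using (_⊎_; inj₁; inj₂)
open import Data.Fin.Subset using (Subset; ∣_∣; _∈_; _∉_; _∩_; _∪_; ⊤) renaming (⊥ to ∅)
open import Data.Fin.Subset.Properties using (_∈?_; ∈⊤; x∈p∩q⁺; x∈p∩q⁻; x∈p∪q⁻; anySubset?)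
open import Data.Vec using (Vec; []; _∷_; _++_; lookup; tabulate; foldr′)
open import Data.Vec.Relation.Unary.All using (All; []; _∷_)
open import Data.Vec.Relation.Unary.All.Properties using (lookup⁺; lookup⁻; ++⁺)
open import Data.Vec.Relation.Binary.Pointwise.Extensional using (ext; Pointwise-≡⇒≡)
open import Data.Vec.Properties
  using (lookup∘tabulate; lookup-zipWith; lookup-replicate; []=⇒lookup; lookup⇒[]=;
         zipWith-assoc; zipWith-identityˡ; ≡-dec)
open import Relation.Binary.PropositionalEquality
open import Relation.Nullary using (Dec; yes; no; does)
open import Relation.Nullary.Decidable using (⌊_⌋; isYes≗does)

open import Algebra.Properties.Semiring.Sum (CommutativeRing.semiring xor-∧-commutativeRing)
  using (sum; sum-syntax; sum-cong-≗; sum-replicate-zero; ∑-distrib-+; ∑-comm;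
         *-distribˡ-sum; *-distribʳ-sum)

-- `does` rather than `⌊_⌋`: the latter is stuck on a neutral decision, so that
-- δ (suc i) (suc j) would not reduce to δ i j.
δ : ∀ {k} → Fin k → Fin k → Bool
δ i j = does (i ≟ j)

∑-zero : ∀ {k} → ∑[ i < k ] false ≡ false
∑-zero {k} = sum-replicate-zero k

∑-δ : ∀ {k} (a : Fin k) (f : Fin k → Bool) → ∑[ i < k ] (δ i a ∧ f i) ≡ f a
∑-δ {suc k} zero    f = trans (cong (f zero xor_) (∑-zero {k})) (xor-identityʳ (f zero))
∑-δ {suc k} (suc a) f = ∑-δ a (λ i → f (suc i))

∑-δ₁ : ∀ {k} (a : Fin k) → ∑[ i < k ] δ i a ≡ true
∑-δ₁ {suc k} zero    = cong not (∑-zero {k})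
∑-δ₁ {suc k} (suc a) = ∑-δ₁ a

δ-sym : ∀ {k} (i j : Fin k) → δ i j ≡ δ j i
δ-sym i j with i ≟ j | j ≟ i
... | yes _   | yes _   = refl
... | no _    | no _    = refl
... | yes i≡j | no j≢i = ⊥-elim (j≢i (sym i≡j))
... | no i≢j  | yes j≡i = ⊥-elim (i≢j (sym j≡i))

∑≡true⇒∃ : ∀ {k} (f : Fin k → Bool) → sum f ≡ true → ∃[ i ] f i ≡ true
∑≡true⇒∃ {suc k} f ∑f with f zero in eq
... | true  = zero , eq
... | false = let i , fi = ∑≡true⇒∃ (λ i → f (suc i)) ∑f in suc i , fi

odd : ℕ → Bool
odd zero    = false
odd (suc n) = not (odd n)

odd-∣∣ : ∀ {k} (X : Subset k) → odd ∣ X ∣ ≡ sum (lookup X)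
odd-∣∣ []          = refl
odd-∣∣ (true ∷ X)  = cong not (odd-∣∣ X)
odd-∣∣ (false ∷ X) = odd-∣∣ X

odd≡false⇒2∣ : ∀ n → odd n ≡ false → 2 ∣ n
odd≡false⇒2∣ zero          _ = divides 0 refl
odd≡false⇒2∣ (suc (suc n)) h with odd≡false⇒2∣ n (trans (sym (not-involutive (odd n))) h)
... | divides q refl = divides (suc q) refl

2∣⇒odd≡false : ∀ n → 2 ∣ n → odd n ≡ false
2∣⇒odd≡false n (divides q refl) = odd-double q
  where
  odd-double : ∀ q → odd (q * 2) ≡ false
  odd-double zero    = refl
  odd-double (suc q) = trans (not-involutive _) (odd-double q)

xor-telescope : ∀ a b c → (a xor b) xor (b xor c) ≡ a xor c
xor-telescope a b c = begin
  (a xor b) xor (b xor c) ≡⟨ xor-assoc a b (b xor c) ⟩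
  a xor (b xor (b xor c)) ≡⟨ cong (a xor_) (sym (xor-assoc b b c)) ⟩
  a xor ((b xor b) xor c) ≡⟨ cong (λ z → a xor (z xor c)) (xor-same b) ⟩
  a xor c                 ∎
  where open ≡-Reasoning

xor-cancelʳ : ∀ a b c → (a xor c) xor (b xor c) ≡ a xor b
xor-cancelʳ a b c = trans (cong ((a xor c) xor_) (xor-comm b c)) (xor-telescope a c b)

∧-split : ∀ a x → (a ∧ x) xor (a ∧ not x) ≡ a
∧-split a x = trans (sym (∧-distribˡ-xor a x (not x)))
                    (trans (cong (a ∧_) (xor-inverseʳ x)) (∧-identityʳ a))

xor≡false⇒≡ : ∀ a b → a xor b ≡ false → a ≡ b
xor≡false⇒≡ true  true  _ = refl
xor≡false⇒≡ false false _ = refl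

xor≡true⇒⊎ : ∀ a b → a xor b ≡ true → a ≡ true ⊎ b ≡ true
xor≡true⇒⊎ true  _ _ = inj₁ refl
xor≡true⇒⊎ false _ h = inj₂ h

⊕≡∅⇒≡ : ∀ {k} {x y : Subset k} → x ⊕ y ≡ ∅ → x ≡ y
⊕≡∅⇒≡ {x = x} {y} x+y≡∅ = Pointwise-≡⇒≡ (ext λ e → xor≡false⇒≡ (lookup x e) (lookup y e) (begin
  lookup x e xor lookup y e ≡⟨ lookup-zipWith _xor_ e x y ⟨
  lookup (x ⊕ y) e          ≡⟨ cong (λ z → lookup z e) x+y≡∅ ⟩
  lookup ∅ e                ≡⟨ lookup-replicate e false ⟩
  false                     ∎))
  where open ≡-Reasoning

⊔-fold-upper : ∀ {k} (f : Fin k → ℕ) i → f i ≤ foldr′ _⊔_ 0 (tabulate f)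
⊔-fold-upper f zero    = m≤m⊔n _ _
⊔-fold-upper f (suc i) = ≤-trans (⊔-fold-upper (λ j → f (suc j)) i) (m≤n⊔m (f zero) _)

⊔-fold-least : ∀ {k} (f : Fin k → ℕ) {M} → (∀ i → f i ≤ M) → foldr′ _⊔_ 0 (tabulate f) ≤ M
⊔-fold-least {zero}  f f≤M = z≤n
⊔-fold-least {suc k} f f≤M =
  ⊔-lub (f≤M zero) (⊔-fold-least (λ j → f (suc j)) (λ j → f≤M (suc j)))

module Boundary (G : Graph) where

  Chain : Set
  Chain = Fin (m G) → Bool

  inc : Fin (n G) → Fin (m G) → Bool
  inc v e = δ v (proj₁ (ends G e)) xor δ v (proj₂ (ends G e))

  ∂ : Chain → Fin (n G) → Bool
  ∂ s v = ∑[ e < m G ] (s e ∧ inc v e)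

  _⊆ᶜ_ : Chain → EdgeSet G → Set
  s ⊆ᶜ E = ∀ e → s e ≡ true → e ∈ E

  ⊆ᶜ-xor : ∀ {s t E} → s ⊆ᶜ E → t ⊆ᶜ E → (λ e → s e xor t e) ⊆ᶜ E
  ⊆ᶜ-xor {s} {t} s⊆E t⊆E e h with xor≡true⇒⊎ (s e) (t e) h
  ... | inj₁ se = s⊆E e se
  ... | inj₂ te = t⊆E e te

  Filling : EdgeSet G → (Fin (n G) → Bool) → Set
  Filling E b = Σ Chain λ p → p ⊆ᶜ E × (∀ v → ∂ p v ≡ b v)

  lookup-incident : ∀ v e → lookup (incident G v) e ≡ inc v e
  lookup-incident v e = trans (lookup∘tabulate _ e) (endpoints (v ≟ _) (v ≟ _))
    where
    endpoints : (p : Dec (v ≡ proj₁ (ends G e))) (q : Dec (v ≡ proj₂ (ends G e))) →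
                ⌊ p ⌋ ∨ ⌊ q ⌋ ≡ does p xor does q
    endpoints (yes v≡x) (yes v≡y) = ⊥-elim (loopless G e (trans (sym v≡x) v≡y))
    endpoints (yes _)   (no _)    = refl
    endpoints (no _)    q         = isYes≗does q

  inc≡true⇒endpoint : ∀ v e → inc v e ≡ true → v ≡ proj₁ (ends G e) ⊎ v ≡ proj₂ (ends G e)
  inc≡true⇒endpoint v e h with v ≟ proj₁ (ends G e) | v ≟ proj₂ (ends G e)
  ... | yes v≡x | _       = inj₁ v≡x
  ... | no _    | yes v≡y = inj₂ v≡y

  inc-ends : ∀ {e u w} → ends G e ≡ (u , w) ⊎ ends G e ≡ (w , u) → ∀ x → inc x e ≡ δ x u xor δ x w
  inc-ends (inj₁ e=uw) x = cong (λ q → δ x (proj₁ q) xor δ x (proj₂ q)) e=uw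
  inc-ends {w = w} (inj₂ e=wu) x =
    trans (cong (λ q → δ x (proj₁ q) xor δ x (proj₂ q)) e=wu) (xor-comm (δ x w) _)

  deg-parity : ∀ S v → odd (deg G S v) ≡ ∂ (lookup S) v
  deg-parity S v = trans (odd-∣∣ (S ∩ incident G v)) (sum-cong-≗ λ e →
    trans (lookup-zipWith _∧_ e S (incident G v)) (cong (lookup S e ∧_) (lookup-incident v e)))

  ∂-cong : ∀ {s t} → (∀ e → s e ≡ t e) → ∀ v → ∂ s v ≡ ∂ t v
  ∂-cong s≗t v = sum-cong-≗ (λ e → cong (_∧ inc v e) (s≗t e))

  ∂-⊕ : ∀ s t v → ∂ (λ e → s e xor t e) v ≡ ∂ s v xor ∂ t v
  ∂-⊕ s t v = trans (sum-cong-≗ λ e → ∧-distribʳ-xor (inc v e) (s e) (t e))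
                    (∑-distrib-+ (λ e → s e ∧ inc v e) (λ e → t e ∧ inc v e))

  ∂-∑ : ∀ {k} (b : Fin k → Bool) (p : Fin k → Chain) v →
        ∂ (λ e → ∑[ w < k ] (b w ∧ p w e)) v ≡ ∑[ w < k ] (b w ∧ ∂ (p w) v)
  ∂-∑ {k} b p v = begin
    ∑[ e < m G ] (∑[ w < k ] (b w ∧ p w e) ∧ inc v e)
      ≡⟨ sum-cong-≗ (λ e → *-distribʳ-sum (inc v e) (λ w → b w ∧ p w e)) ⟩
    ∑[ e < m G ] ∑[ w < k ] ((b w ∧ p w e) ∧ inc v e)
      ≡⟨ ∑-comm (λ e w → (b w ∧ p w e) ∧ inc v e) ⟩
    ∑[ w < k ] ∑[ e < m G ] ((b w ∧ p w e) ∧ inc v e)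
      ≡⟨ sum-cong-≗ (λ w → sum-cong-≗ λ e → ∧-assoc (b w) (p w e) (inc v e)) ⟩
    ∑[ w < k ] ∑[ e < m G ] (b w ∧ (p w e ∧ inc v e))
      ≡⟨ sum-cong-≗ (λ w → sym (*-distribˡ-sum (b w) (λ e → p w e ∧ inc v e))) ⟩
    ∑[ w < k ] (b w ∧ ∂ (p w) v) ∎
    where open ≡-Reasoning

  handshake : ∀ s → ∑[ v < n G ] ∂ s v ≡ false
  handshake s = begin
    ∑[ v < n G ] ∑[ e < m G ] (s e ∧ inc v e)
      ≡⟨ ∑-comm (λ v e → s e ∧ inc v e) ⟩
    ∑[ e < m G ] ∑[ v < n G ] (s e ∧ inc v e)
      ≡⟨ sum-cong-≗ (λ e → sym (*-distribˡ-sum (s e) (λ v → inc v e))) ⟩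
    ∑[ e < m G ] (s e ∧ ∑[ v < n G ] inc v e)
      ≡⟨ sum-cong-≗ (λ e → trans (cong (s e ∧_) (∑-inc e)) (∧-zeroʳ (s e))) ⟩
    ∑[ e < m G ] false
      ≡⟨ ∑-zero {m G} ⟩
    false ∎
    where
    open ≡-Reasoning
    ∑-inc : ∀ e → ∑[ v < n G ] inc v e ≡ false
    ∑-inc e = trans (∑-distrib-+ (λ v → δ v (proj₁ (ends G e))) (λ v → δ v (proj₂ (ends G e))))
      (cong₂ _xor_ (∑-δ₁ (proj₁ (ends G e))) (∑-δ₁ (proj₂ (ends G e))))

  reach⇒filling : ∀ {V E u v} → Reach G V E u v → Filling E (λ x → δ x u xor δ x v)
  reach⇒filling {u = u} (here _) =
    (λ _ → false) , (λ _ ()) , λ x → trans (∑-zero {m G}) (sym (xor-same (δ x u)))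
  reach⇒filling {E = E} {u} {v} (step {w = w} e e∈E uw _ rest) with reach⇒filling rest
  ... | p , p⊆E , ∂p = (λ f → δ f e xor p f) , e+p⊆E , ∂[e+p]
    where
    e+p⊆E : (λ f → δ f e xor p f) ⊆ᶜ E
    e+p⊆E f h with f ≟ e
    ... | yes refl = e∈E
    ... | no _     = p⊆E f h
    ∂[e+p] : ∀ x → ∂ (λ f → δ f e xor p f) x ≡ δ x u xor δ x v
    ∂[e+p] x = begin
      ∂ (λ f → δ f e xor p f) x                 ≡⟨ ∂-⊕ (λ f → δ f e) p x ⟩
      ∂ (λ f → δ f e) x xor ∂ p x               ≡⟨ cong₂ _xor_ (∑-δ e (λ f → inc x f)) (∂p x) ⟩
      inc x e xor (δ x w xor δ x v)             ≡⟨ cong (_xor (δ x w xor δ x v)) (inc-ends uw x) ⟩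
      (δ x u xor δ x w) xor (δ x w xor δ x v)   ≡⟨ xor-telescope (δ x u) (δ x w) (δ x v) ⟩
      δ x u xor δ x v                           ∎
      where open ≡-Reasoning

  connected⇒filling : ∀ {V E} → Connected G V E → (b : Fin (n G) → Bool) →
    (∀ v → v ∉ V → b v ≡ false) → ∑[ v < n G ] b v ≡ false → Filling E b
  connected⇒filling {V} {E} ((r , r∈V) , reach) b b≡0-off-V ∑b≡0 = t , t⊆E , ∂t≡b
    where
    -- t sums, over the w with b w = true, a path from the root r to w; hence
    -- ∂ t = b + (∑ b) δ r = b. Off V the path is a dummy, as b vanishes there.
    path : ∀ w → Σ Chain λ p → p ⊆ᶜ E × (w ∈ V → ∀ x → ∂ p x ≡ δ x r xor δ x w)
    path w with w ∈? V
    ... | yes w∈V = let p , p⊆E , ∂p = reach⇒filling (reach r w r∈V w∈V) in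
                    p , p⊆E , λ _ → ∂p
    ... | no  w∉V = (λ _ → false) , (λ _ ()) , λ w∈V → ⊥-elim (w∉V w∈V)
    P : Fin (n G) → Chain
    P w = proj₁ (path w)
    t : Chain
    t e = ∑[ w < n G ] (b w ∧ P w e)
    t⊆E : t ⊆ᶜ E
    t⊆E e te = let w , bP = ∑≡true⇒∃ (λ w → b w ∧ P w e) te in
      proj₁ (proj₂ (path w)) e (∧-conicalʳ (b w) (P w e) bP)
    summand : ∀ x w → b w ∧ ∂ (P w) x ≡ (b w ∧ δ x r) xor (δ w x ∧ b w)
    summand x w = by-membership (w ∈? V)
      where
      open ≡-Reasoning
      by-membership : Dec (w ∈ V) → b w ∧ ∂ (P w) x ≡ (b w ∧ δ x r) xor (δ w x ∧ b w)
      by-membership (no w∉V) rewrite b≡0-off-V w w∉V = sym (∧-zeroʳ (δ w x))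
      by-membership (yes w∈V) = begin
        b w ∧ ∂ (P w) x
          ≡⟨ cong (b w ∧_) (proj₂ (proj₂ (path w)) w∈V x) ⟩
        b w ∧ (δ x r xor δ x w)
          ≡⟨ ∧-distribˡ-xor (b w) (δ x r) (δ x w) ⟩
        (b w ∧ δ x r) xor (b w ∧ δ x w)
          ≡⟨ cong ((b w ∧ δ x r) xor_) (trans (∧-comm (b w) (δ x w)) (cong (_∧ b w) (δ-sym x w))) ⟩
        (b w ∧ δ x r) xor (δ w x ∧ b w) ∎
    ∂t≡b : ∀ x → ∂ t x ≡ b x
    ∂t≡b x = begin
      ∂ t x
        ≡⟨ ∂-∑ b P x ⟩
      ∑[ w < n G ] (b w ∧ ∂ (P w) x)
        ≡⟨ sum-cong-≗ (summand x) ⟩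
      ∑[ w < n G ] ((b w ∧ δ x r) xor (δ w x ∧ b w))
        ≡⟨ ∑-distrib-+ (λ w → b w ∧ δ x r) (λ w → δ w x ∧ b w) ⟩
      ∑[ w < n G ] (b w ∧ δ x r) xor ∑[ w < n G ] (δ w x ∧ b w)
        ≡⟨ cong₂ _xor_ (sym (*-distribʳ-sum (δ x r) b)) (∑-δ x b) ⟩
      (∑[ w < n G ] b w ∧ δ x r) xor b x
        ≡⟨ cong (λ z → (z ∧ δ x r) xor b x) ∑b≡0 ⟩
      b x ∎
      where open ≡-Reasoning

  inc⇒∈V : (H : Subgraph G) → ∀ {v e} → e ∈ E H → inc v e ≡ true → v ∈ V H
  inc⇒∈V H {v} {e} e∈H ie with inc≡true⇒endpoint v e ie | closed H e e∈H
  ... | inj₁ refl | x∈H , _ = x∈H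
  ... | inj₂ refl | _ , y∈H = y∈H

  ∂-outside : (H : Subgraph G) → ∀ {s} → s ⊆ᶜ E H → ∀ {v} → v ∉ V H → ∂ s v ≡ false
  ∂-outside H {s} s⊆H {v} v∉H = trans (sum-cong-≗ summand) (∑-zero {m G})
    where
    summand : ∀ e → s e ∧ inc v e ≡ false
    summand e with s e in se | inc v e in ie
    ... | false | _     = refl
    ... | true  | false = refl
    ... | true  | true  = ⊥-elim (v∉H (inc⇒∈V H (s⊆H e se) ie))

  IsCycle⇒∂≡0 : ∀ {H S} → IsCycle G H S → ∀ v → ∂ (lookup S) v ≡ false
  IsCycle⇒∂≡0 {S = S} (_ , even) v = trans (sym (deg-parity S v)) (2∣⇒odd≡false _ (even v))

  ∂≡0⇒IsCycle : ∀ {H} c → c ⊆ᶜ H → (∀ v → ∂ c v ≡ false) → IsCycle G H (tabulate c)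
  ∂≡0⇒IsCycle c c⊆H ∂c≡0 =
    (λ {e} e∈c → c⊆H e (trans (sym (lookup∘tabulate c e)) ([]=⇒lookup e∈c))) ,
    λ v → odd≡false⇒2∣ _ (trans (deg-parity (tabulate c) v)
                            (trans (∂-cong (lookup∘tabulate c) v) (∂c≡0 v)))

module Families (G : Graph) where

  InSpan : ∀ {k} → Vec (EdgeSet G) k → EdgeSet G → Set
  InSpan B S = ∃[ c ] lincomb G c B ≡ S

  span? : ∀ {k} (B : Vec (EdgeSet G) k) S → Dec (InSpan B S)
  span? B S = anySubset? (λ c → ≡-dec _≟ᵇ_ (lincomb G c B) S)

  lincomb-++ : ∀ {k l} (c : Vec Bool k) (d : Vec Bool l) B C →
               lincomb G (c ++ d) (B ++ C) ≡ lincomb G c B ⊕ lincomb G d C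
  lincomb-++ []          d []      C = sym (zipWith-identityˡ xor-identityˡ (lincomb G d C))
  lincomb-++ (true ∷ c)  d (x ∷ B) C =
    trans (cong (x ⊕_) (lincomb-++ c d B C))
          (sym (zipWith-assoc xor-assoc x (lincomb G c B) (lincomb G d C)))
  lincomb-++ (false ∷ c) d (x ∷ B) C = lincomb-++ c d B C

  lookup-lincomb : ∀ {k} (c : Vec Bool k) B e →
                   lookup (lincomb G c B) e ≡ ∑[ i < k ] (lookup c i ∧ lookup (lookup B i) e)
  lookup-lincomb []          []      e = lookup-replicate e false
  lookup-lincomb (true ∷ c)  (x ∷ B) e =
    trans (lookup-zipWith _xor_ e x (lincomb G c B)) (cong (lookup x e xor_) (lookup-lincomb c B e))
  lookup-lincomb (false ∷ c) (x ∷ B) e = lookup-lincomb c B e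

  lincomb-⊕ : ∀ {k} (c d : Vec Bool k) B → lincomb G (c ⊕ d) B ≡ lincomb G c B ⊕ lincomb G d B
  lincomb-⊕ {k} c d B = Pointwise-≡⇒≡ (ext λ e → begin
    lookup (lincomb G (c ⊕ d) B) e
      ≡⟨ lookup-lincomb (c ⊕ d) B e ⟩
    ∑[ i < k ] (lookup (c ⊕ d) i ∧ b i e)
      ≡⟨ sum-cong-≗ (λ i → trans (cong (_∧ b i e) (lookup-zipWith _xor_ i c d))
                                (∧-distribʳ-xor (b i e) (lookup c i) (lookup d i))) ⟩
    ∑[ i < k ] ((lookup c i ∧ b i e) xor (lookup d i ∧ b i e))
      ≡⟨ ∑-distrib-+ (λ i → lookup c i ∧ b i e) (λ i → lookup d i ∧ b i e) ⟩
    ∑[ i < k ] (lookup c i ∧ b i e) xor ∑[ i < k ] (lookup d i ∧ b i e)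
      ≡⟨ cong₂ _xor_ (lookup-lincomb c B e) (lookup-lincomb d B e) ⟨
    lookup (lincomb G c B) e xor lookup (lincomb G d B) e
      ≡⟨ lookup-zipWith _xor_ e (lincomb G c B) (lincomb G d B) ⟨
    lookup (lincomb G c B ⊕ lincomb G d B) e ∎)
    where
    open ≡-Reasoning
    b : Fin k → Fin (m G) → Bool
    b i = lookup (lookup B i)

  load-∷ : ∀ {k} x (B : Vec (EdgeSet G) k) e → load G B e ≤ load G (x ∷ B) e
  load-∷ x B e with lookup x e
  ... | true  = n≤1+n _
  ... | false = ≤-refl

  load-∷-mono : ∀ {k l} x {B : Vec (EdgeSet G) k} {C : Vec (EdgeSet G) l} e →
                load G B e ≤ load G C e → load G (x ∷ B) e ≤ load G (x ∷ C) e
  load-∷-mono x e B≤C with lookup x e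
  ... | true  = s≤s B≤C
  ... | false = B≤C

  load-++ : ∀ {k l} (B : Vec (EdgeSet G) k) (C : Vec (EdgeSet G) l) e →
            load G (B ++ C) e ≡ load G B e + load G C e
  load-++ []      C e = refl
  load-++ (x ∷ B) C e with lookup x e
  ... | true  = cong suc (load-++ B C e)
  ... | false = load-++ B C e

  congestion-mono : ∀ {k l} (B : Vec (EdgeSet G) k) (C : Vec (EdgeSet G) l) →
                    (∀ e → load G B e ≤ load G C e) → congestion G B ≤ congestion G C
  congestion-mono B C B≤C =
    ⊔-fold-least _ (λ e → ≤-trans (B≤C e) (⊔-fold-upper (load G C) e))

  congestion-++ : ∀ {k l} (B : Vec (EdgeSet G) k) (C : Vec (EdgeSet G) l) →
                  congestion G (B ++ C) ≤ congestion G B + congestion G C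
  congestion-++ B C = ⊔-fold-least _ λ e →
    subst (_≤ congestion G B + congestion G C) (sym (load-++ B C e))
          (+-mono-≤ (⊔-fold-upper (load G B) e) (⊔-fold-upper (load G C) e))

  record Pruning {k} (B : Vec (EdgeSet G) k) : Set₁ where
    field
      {size}      : ℕ
      family      : Vec (EdgeSet G) size
      members     : ∀ {P : EdgeSet G → Set} → All P B → All P family
      independent : LinIndep G family
      spanning    : ∀ c → InSpan family (lincomb G c B)
      load≤       : ∀ e → load G family e ≤ load G B e

  extend : ∀ {k} x {B : Vec (EdgeSet G) k} → Pruning B → Pruning (x ∷ B)
  extend x {B} p with span? (Pruning.family p) x
  ... | yes (d , d≡x) = record
    { family      = family
    ; members     = λ { (_ ∷ pB) → members pB }
    ; independent = independent
    ; spanning    = λ { (false ∷ c) → spanning c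
                      ; (true ∷ c)  → let c′ , c′≡ = spanning c in
                          d ⊕ c′ , trans (lincomb-⊕ d c′ family) (cong₂ _⊕_ d≡x c′≡) }
    ; load≤       = λ e → ≤-trans (load≤ e) (load-∷ x B e)
    }
    where open Pruning p
  ... | no x∉span = record
    { family      = x ∷ family
    ; members     = λ { (px ∷ pB) → px ∷ members pB }
    ; independent = λ { (false ∷ c) c≡∅ → cong (false ∷_) (independent c c≡∅)
                      ; (true ∷ c)  x+c≡∅ → ⊥-elim (x∉span (c , sym (⊕≡∅⇒≡ x+c≡∅))) }
    ; spanning    = λ { (false ∷ c) → let c′ , c′≡ = spanning c in false ∷ c′ , c′≡
                      ; (true ∷ c)  → let c′ , c′≡ = spanning c in true ∷ c′ , cong (x ⊕_) c′≡ }
    ; load≤       = λ e → load-∷-mono x e (load≤ e)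
    }
    where open Pruning p

  prune : ∀ {k} (B : Vec (EdgeSet G) k) → Pruning B
  prune []      = record
    { family      = []
    ; members     = λ _ → []
    ; independent = λ { [] _ → refl }
    ; spanning    = λ { [] → [] , refl }
    ; load≤       = λ _ → z≤n
    }
  prune (x ∷ B) = extend x (prune B)

  basis-cycles : ∀ {H k} {B : Vec (EdgeSet G) k} → IsCycleBasis G H B → All (IsCycle G ⊤) B
  basis-cycles (cyc , _) = lookup⁻ (λ i → (λ _ → ∈⊤) , proj₂ (cyc i))

  IsBn⇒≤congestion : ∀ {H b k} {B : Vec (EdgeSet G) k} → IsBn G H b →
    All (IsCycle G H) B → Generates G H B → b ≤ congestion G B
  IsBn⇒≤congestion {H} {B = B} (_ , minimal) cycles generates =
    ≤-trans (minimal family basis) (congestion-mono family B load≤)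
    where
    open Pruning (prune B)
    basis : IsCycleBasis G H family
    basis = lookup⁺ (members cycles) , independent , λ S cyc →
      let c , c≡S = generates S cyc
          c′ , c′≡ = spanning c
      in c′ , trans c′≡ c≡S

module Decomposition (G : Graph) (GX GY : Subgraph G) (cover : E GX ∪ E GY ≡ ⊤)
  (conn : Connected G (V GX ∩ V GY) (E GX ∩ E GY)) where
  open Boundary G
  open Families G

  module Split {S : EdgeSet G} (cyc : IsCycle G ⊤ S) where

    inX : Fin (m G) → Bool
    inX = lookup (E GX)

    sX sY : Chain
    sX e = lookup S e ∧ inX e
    sY e = lookup S e ∧ not (inX e)

    sX⊆X : sX ⊆ᶜ E GX
    sX⊆X e h = lookup⇒[]= e (E GX) (∧-conicalʳ (lookup S e) (inX e) h)

    sY⊆Y : sY ⊆ᶜ E GY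
    sY⊆Y e h with x∈p∪q⁻ (E GX) (E GY) (subst (e ∈_) (sym cover) ∈⊤)
    ... | inj₂ e∈Y = e∈Y
    ... | inj₁ e∈X =
      ⊥-elim (not-¬ (sym ([]=⇒lookup e∈X)) (sym (∧-conicalʳ (lookup S e) (not (inX e)) h)))

    ∂sX≡∂sY : ∀ v → ∂ sX v ≡ ∂ sY v
    ∂sX≡∂sY v = xor≡false⇒≡ (∂ sX v) (∂ sY v) (begin
      ∂ sX v xor ∂ sY v          ≡⟨ ∂-⊕ sX sY v ⟨
      ∂ (λ e → sX e xor sY e) v  ≡⟨ ∂-cong (λ e → ∧-split (lookup S e) (inX e)) v ⟩
      ∂ (lookup S) v             ≡⟨ IsCycle⇒∂≡0 cyc v ⟩
      false                      ∎)
      where open ≡-Reasoning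

    ∂sX-outside : ∀ v → v ∉ V GX ∩ V GY → ∂ sX v ≡ false
    ∂sX-outside v v∉I with v ∈? V GX | v ∈? V GY
    ... | no v∉X  | _       = ∂-outside GX sX⊆X v∉X
    ... | yes _   | no v∉Y  = trans (∂sX≡∂sY v) (∂-outside GY sY⊆Y v∉Y)
    ... | yes v∈X | yes v∈Y = ⊥-elim (v∉I (x∈p∩q⁺ (v∈X , v∈Y)))

    filling : Filling (E GX ∩ E GY) (∂ sX)
    filling = connected⇒filling conn (∂ sX) ∂sX-outside (handshake sX)

    t : Chain
    t = proj₁ filling

    t⊆X∩Y : ∀ e → t e ≡ true → e ∈ E GX × e ∈ E GY
    t⊆X∩Y e h = x∈p∩q⁻ (E GX) (E GY) (proj₁ (proj₂ filling) e h)

    ∂t≡∂sX : ∀ v → ∂ t v ≡ ∂ sX v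
    ∂t≡∂sX = proj₂ (proj₂ filling)

    cX cY : Chain
    cX e = sX e xor t e
    cY e = sY e xor t e

    cX⊆X : cX ⊆ᶜ E GX
    cX⊆X = ⊆ᶜ-xor sX⊆X (λ e h → proj₁ (t⊆X∩Y e h))

    cY⊆Y : cY ⊆ᶜ E GY
    cY⊆Y = ⊆ᶜ-xor sY⊆Y (λ e h → proj₂ (t⊆X∩Y e h))

    ∂cX≡0 : ∀ v → ∂ cX v ≡ false
    ∂cX≡0 v = trans (∂-⊕ sX t v)
      (trans (cong (∂ sX v xor_) (∂t≡∂sX v)) (xor-same (∂ sX v)))

    ∂cY≡0 : ∀ v → ∂ cY v ≡ false
    ∂cY≡0 v = trans (∂-⊕ sY t v)
      (trans (cong₂ _xor_ (sym (∂sX≡∂sY v)) (∂t≡∂sX v)) (xor-same (∂ sX v)))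

    cX+cY≡S : ∀ e → lookup (tabulate cX ⊕ tabulate cY) e ≡ lookup S e
    cX+cY≡S e = begin
      lookup (tabulate cX ⊕ tabulate cY) e
        ≡⟨ lookup-zipWith _xor_ e (tabulate cX) (tabulate cY) ⟩
      lookup (tabulate cX) e xor lookup (tabulate cY) e
        ≡⟨ cong₂ _xor_ (lookup∘tabulate cX e) (lookup∘tabulate cY e) ⟩
      cX e xor cY e
        ≡⟨ xor-cancelʳ (sX e) (sY e) (t e) ⟩
      sX e xor sY e
        ≡⟨ ∧-split (lookup S e) (inX e) ⟩
      lookup S e ∎
      where open ≡-Reasoning

  cycle-split : ∀ {S} → IsCycle G ⊤ S →
    ∃₂ λ CX CY → IsCycle G (E GX) CX × IsCycle G (E GY) CY × CX ⊕ CY ≡ S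
  cycle-split cyc =
    tabulate cX , tabulate cY , ∂≡0⇒IsCycle cX cX⊆X ∂cX≡0 , ∂≡0⇒IsCycle cY cY⊆Y ∂cY≡0 ,
    Pointwise-≡⇒≡ (ext cX+cY≡S)
    where open Split cyc

  cycle-bases-generate : ∀ {kX kY} (BX : Vec (EdgeSet G) kX) (BY : Vec (EdgeSet G) kY) →
    IsCycleBasis G (E GX) BX → IsCycleBasis G (E GY) BY → Generates G ⊤ (BX ++ BY)
  cycle-bases-generate BX BY (_ , _ , genX) (_ , _ , genY) S cyc with cycle-split cyc
  ... | CX , CY , cycX , cycY , refl =
    let cX , cX≡CX = genX CX cycX
        cY , cY≡CY = genY CY cycY
    in cX ++ cY , trans (lincomb-++ cX cY BX BY) (cong₂ _⊕_ cX≡CX cY≡CY)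

  bn-subadditive : ∀ a b c → IsBn G ⊤ a → IsBn G (E GX) b → IsBn G (E GY) c → a ≤ b + c
  bn-subadditive a _ _ bnG ((_ , BX , basX , refl) , _) ((_ , BY , basY , refl) , _) =
    ≤-trans (IsBn⇒≤congestion bnG (++⁺ (basis-cycles basX) (basis-cycles basY))
                                  (cycle-bases-generate BX BY basX basY))
            (congestion-++ BX BY)

lemma2p3 : (G : Graph) (GX GY : Subgraph G) →
    V GX ∪ V GY ≡ ⊤ → E GX ∪ E GY ≡ ⊤ →
    Connected G (V GX ∩ V GY) (E GX ∩ E GY) →
    (∀ {kX kY} (BX : Vec (EdgeSet G) kX) (BY : Vec (EdgeSet G) kY) →
       IsCycleBasis G (E GX) BX → IsCycleBasis G (E GY) BY →
       Generates G ⊤ (BX ++ BY))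
    × (∀ a b c → IsBn G ⊤ a → IsBn G (E GX) b → IsBn G (E GY) c → a ≤ b + c)
lemma2p3 G GX GY _ cover conn = cycle-bases-generate , bn-subadditive
  where open Decomposition G GX GY cover conn
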